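{- Let $\mathcal{F}\subset 2^{[n]}$ be shifted and suppose $\{i,j\}\notin\mathcal{F}$ with $i<j$. Then $y_{\mathcal{F}}(2)\ge\frac{(n+j-2i)(n-j+1)}{2}$. Moreover, equality is achieved only if $\mathcal{F}^{(2)}$ is the family of all two-element subsets of $[n]$ that cannot be shifted to $\{i,j\}$.
   Context: $[n]=\{1,\dots,n\}$. For a family $\mathcal{F}$, $\mathcal{F}^{(2)}=\mathcal{F}\cap\binom{[n]}{2}$ and $y_{\mathcal{F}}(2)=\binom{n}{2}-|\mathcal{F}^{(2)}|$. For $a<b$ and $A\subset[n]$, $S_{a\leftarrow b}(A)=(A\setminus\{b\})\cup\{a\}$ if $b\in A$, $a\notin A$, and $S_{a\leftarrow b}(A)=A$ otherwise. A set $A$ can be shifted to $B$ if some sequence of shifts $S_{a\leftarrow b}$ with $a<b$ transforms $A$ into $B$. For a family, $S_{a\leftarrow b}(\mathcal{F})=\{S_{a\leftarrow b}(A):A\in\mathcal{F}\}\cup\{A\in\mathcal{F}: S_{a\leftarrow b}(A)\in\mathcal{F}\}$; $\mathcal{F}$ is shifted if $S_{a\leftarrow b}(\mathcal{F})=\mathcal{F}$ for all $1\le a<b\le n$. -}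

module Defs where

open import Data.Bool using (Bool; true; false; if_then_else_; _∧_; not)
open import Data.Nat using (ℕ; zero; suc; _+_; _*_; _∸_; _≡ᵇ_)
open import Data.Nat.Combinatorics using (_C_)
open import Data.Fin using (Fin; _<_)
open import Data.Fin.Subset using (Subset; ∣_∣)
open import Data.Vec using (Vec; []; _∷_; lookup; _[_]≔_)
open import Data.List using (List; []; _∷_; _++_; map; filter; length)
open import Data.Product using (Σ; _×_)
open import Data.Sum using (_⊎_)
open import Relation.Binary.PropositionalEquality using (_≡_)
open import Relation.Binary.Construct.Closure.ReflexiveTransitive using (Star)
open import Relation.Nullary.Decidable using (yes; no)
open import Data.Bool.Properties using (T?)

-- A family of subsets of [n] (elements of [n] are Fin n, i.e. k ↦ k+1),
-- given by its (Boolean) characteristic function.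
Family : ℕ → Set
Family n = Subset n → Bool

allSubsets : (n : ℕ) → List (Subset n)
allSubsets zero    = [] ∷ []
allSubsets (suc n) = map (true ∷_) (allSubsets n) ++ map (false ∷_) (allSubsets n)

card2 : ∀ {n} → Family n → ℕ
card2 {n} F = length (filter (λ A → T? (F A ∧ (∣ A ∣ ≡ᵇ 2))) (allSubsets n))

y2 : ∀ {n} → Family n → ℕ
y2 {n} F = (n C 2) ∸ card2 F

shift : ∀ {n} → Fin n → Fin n → Subset n → Subset n
shift a b A =
  if lookup A b ∧ not (lookup A a) then (A [ b ]≔ false) [ a ]≔ true else A

InShift : ∀ {n} → Family n → Fin n → Fin n → Subset n → Set
InShift {n} F a b B =
  (Σ (Subset n) λ A → (F A ≡ true) × (shift a b A ≡ B))
  ⊎ ((F B ≡ true) × (F (shift a b B) ≡ true))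

Shifted : ∀ {n} → Family n → Set
Shifted {n} F = ∀ (a b : Fin n) → a < b → ∀ (B : Subset n) →
  (InShift F a b B → F B ≡ true) × (F B ≡ true → InShift F a b B)

ShiftStep : ∀ {n} → Subset n → Subset n → Set
ShiftStep {n} A B = Σ (Fin n) λ a → Σ (Fin n) λ b → (a < b) × (shift a b A ≡ B)

CanShiftTo : ∀ {n} → Subset n → Subset n → Set
CanShiftTo = Star ShiftStep

-- The two-element sets that can be shifted to {i, j} are the pairs {a, b} with
-- i ≤ a < b and j ≤ b; there are (n + j - 2i)(n - j + 1)/2 of them (one-indexed).
-- A shifted family is closed under shifting its members, so it contains none of
-- them, as it misses {i, j}; this gives the bound. If equality holds, they are
-- exactly the missing pairs, so every other two-element set belongs to the family.
module Submission where

open import Defs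
open import Data.Bool using (Bool; true; false; _∧_; not; if_then_else_)
open import Data.Bool.Properties using (T?; ∧-comm; not-¬)
open import Data.Nat using (ℕ; zero; suc; _+_; _*_; _∸_; _≤_; _≡ᵇ_; z≤n; s≤s)
import Data.Nat as ℕ
open import Data.Nat.Properties
open import Data.Nat.Combinatorics using (_C_; nCk+nC[k+1]≡[n+1]C[k+1])
open import Data.Fin using (Fin; zero; suc; toℕ; _<_)
open import Data.Fin.Subset using (Subset; ⊥; ⁅_⁆; _∪_; ∣_∣)
open import Data.Fin.Subset.Properties using (∣⊥∣≡0; ∪-identityˡ)
open import Data.Vec using ([]; _∷_; lookup; _[_]≔_)
open import Data.List using (List; []; _∷_; _++_; map; filter; length)
open import Data.List.Membership.Propositional using (_∈_)
open import Data.List.Membership.Propositional.Properties using (∈-++⁺ˡ; ∈-++⁺ʳ; ∈-map⁺)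
open import Data.List.Relation.Unary.Any using (here; there)
open import Data.Product using (Σ; _×_; _,_; proj₁)
open import Data.Sum using (inj₁)
open import Relation.Binary.PropositionalEquality
open import Relation.Binary.Construct.Closure.ReflexiveTransitive using (ε; _◅_; gmap)
open import Relation.Nullary using (¬_; contradiction)

module _ {A : Set} where

  count : (A → Bool) → List A → ℕ
  count P []       = 0
  count P (x ∷ xs) = if P x then suc (count P xs) else count P xs

  length-filter≡count : ∀ P xs → length (filter (λ a → T? (P a)) xs) ≡ count P xs
  length-filter≡count P []       = refl
  length-filter≡count P (x ∷ xs) with P x
  ... | true  = cong suc (length-filter≡count P xs)
  ... | false = length-filter≡count P xs

  count-++ : ∀ P xs ys → count P (xs ++ ys) ≡ count P xs + count P ys
  count-++ P []       ys = refl
  count-++ P (x ∷ xs) ys with P x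
  ... | true  = cong suc (count-++ P xs ys)
  ... | false = count-++ P xs ys

  count-false : ∀ xs → count (λ _ → false) xs ≡ 0
  count-false []       = refl
  count-false (_ ∷ xs) = count-false xs

  count-cong : ∀ {P Q} → (∀ a → P a ≡ Q a) → ∀ xs → count P xs ≡ count Q xs
  count-cong P≗Q []       = refl
  count-cong {Q = Q} P≗Q (x ∷ xs) rewrite P≗Q x with Q x
  ... | true  = cong suc (count-cong P≗Q xs)
  ... | false = count-cong P≗Q xs

  count-mono : ∀ {P Q} → (∀ a → P a ≡ true → Q a ≡ true) → ∀ xs → count P xs ≤ count Q xs
  count-mono P⇒Q [] = z≤n
  count-mono {P} {Q} P⇒Q (x ∷ xs) with P x in Px | Q x in Qx
  ... | true  | true  = s≤s (count-mono P⇒Q xs)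
  ... | true  | false = contradiction Qx (not-¬ (P⇒Q x Px))
  ... | false | true  = m≤n⇒m≤1+n (count-mono P⇒Q xs)
  ... | false | false = count-mono P⇒Q xs

  count-mono-< : ∀ {P Q} → (∀ a → P a ≡ true → Q a ≡ true) →
                 ∀ {x xs} → x ∈ xs → P x ≡ false → Q x ≡ true → count P xs ℕ.< count Q xs
  count-mono-< {P} {Q} P⇒Q {xs = y ∷ ys} (here refl) Px Qx rewrite Px | Qx =
    s≤s (count-mono P⇒Q ys)
  count-mono-< {P} {Q} P⇒Q {xs = y ∷ ys} (there x∈ys) Px Qx with P y in Py | Q y in Qy
  ... | true  | true  = s≤s (count-mono-< P⇒Q x∈ys Px Qx)
  ... | true  | false = contradiction Qy (not-¬ (P⇒Q y Py))
  ... | false | true  = m≤n⇒m≤1+n (count-mono-< P⇒Q x∈ys Px Qx)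
  ... | false | false = count-mono-< P⇒Q x∈ys Px Qx

  count-mono-≡⇒ : ∀ {P Q} → (∀ a → P a ≡ true → Q a ≡ true) → ∀ {xs} → count P xs ≡ count Q xs →
                  ∀ {x} → x ∈ xs → Q x ≡ true → P x ≡ true
  count-mono-≡⇒ {P} P⇒Q P≡Q {x} x∈xs Qx with P x in Px
  ... | true  = refl
  ... | false = contradiction P≡Q (<⇒≢ (count-mono-< P⇒Q x∈xs Px Qx))

  count-∧-not : ∀ (P Q : A → Bool) xs →
                count P xs ≡ count (λ a → P a ∧ Q a) xs + count (λ a → P a ∧ not (Q a)) xs
  count-∧-not P Q []       = refl
  count-∧-not P Q (x ∷ xs) with P x | Q x
  ... | true  | true  = cong suc (count-∧-not P Q xs)
  ... | true  | false = trans (cong suc (count-∧-not P Q xs)) (sym (+-suc _ _))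
  ... | false | _     = count-∧-not P Q xs

count-map : ∀ {A B : Set} (P : B → Bool) (f : A → B) xs → count P (map f xs) ≡ count (λ a → P (f a)) xs
count-map P f []       = refl
count-map P f (x ∷ xs) with P (f x)
... | true  = cong suc (count-map P f xs)
... | false = count-map P f xs

∈-allSubsets : ∀ {n} (A : Subset n) → A ∈ allSubsets n
∈-allSubsets []          = here refl
∈-allSubsets (true ∷ A)  = ∈-++⁺ˡ (∈-map⁺ (true ∷_) (∈-allSubsets A))
∈-allSubsets (false ∷ A) = ∈-++⁺ʳ (map (true ∷_) _) (∈-map⁺ (false ∷_) (∈-allSubsets A))

count-allSubsets-suc : ∀ n (P : Subset (suc n) → Bool) →
  count P (allSubsets (suc n)) ≡
  count (λ A → P (true ∷ A)) (allSubsets n) + count (λ A → P (false ∷ A)) (allSubsets n)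
count-allSubsets-suc n P = begin
  count P (map (true ∷_) (allSubsets n) ++ map (false ∷_) (allSubsets n))
    ≡⟨ count-++ P (map (true ∷_) (allSubsets n)) _ ⟩
  count P (map (true ∷_) (allSubsets n)) + count P (map (false ∷_) (allSubsets n))
    ≡⟨ cong₂ _+_ (count-map P (true ∷_) (allSubsets n)) (count-map P (false ∷_) (allSubsets n)) ⟩
  count (λ A → P (true ∷ A)) (allSubsets n) + count (λ A → P (false ∷ A)) (allSubsets n) ∎
  where open ≡-Reasoning

count-size≡C : ∀ n k → count (λ (A : Subset n) → ∣ A ∣ ≡ᵇ k) (allSubsets n) ≡ n C k
count-size≡C zero    zero    = refl
count-size≡C zero    (suc k) = refl
count-size≡C (suc n) zero
  rewrite count-allSubsets-suc n (λ A → ∣ A ∣ ≡ᵇ 0) | count-false (allSubsets n) = count-size≡C n 0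
count-size≡C (suc n) (suc k) rewrite count-allSubsets-suc n (λ A → ∣ A ∣ ≡ᵇ suc k) =
  trans (cong₂ _+_ (count-size≡C n k) (count-size≡C n (suc k))) (nCk+nC[k+1]≡[n+1]C[k+1] n k)

-- isSingleton≥ j A holds iff A = {b} with j ≤ b, and isPair≥ i j A iff A = {a, b}
-- with i ≤ a < b and j ≤ b; the bounds are lowered by one at every position passed.
isEmpty : ∀ {n} → Subset n → Bool
isEmpty []      = true
isEmpty (x ∷ A) = not x ∧ isEmpty A

isSingleton≥ : ∀ {n} → ℕ → Subset n → Bool
isSingleton≥ j       []      = false
isSingleton≥ zero    (x ∷ A) = if x then isEmpty A else isSingleton≥ zero A
isSingleton≥ (suc j) (x ∷ A) = not x ∧ isSingleton≥ j A

isPair≥ : ∀ {n} → ℕ → ℕ → Subset n → Bool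
isPair≥ i       j []      = false
isPair≥ zero    j (x ∷ A) = if x then isSingleton≥ (j ∸ 1) A else isPair≥ zero (j ∸ 1) A
isPair≥ (suc i) j (x ∷ A) = not x ∧ isPair≥ i (j ∸ 1) A

isEmpty⇒≡⊥ : ∀ {n} (A : Subset n) → isEmpty A ≡ true → A ≡ ⊥
isEmpty⇒≡⊥ []          _ = refl
isEmpty⇒≡⊥ (false ∷ A) e = cong (false ∷_) (isEmpty⇒≡⊥ A e)

isSingleton≥⇒size≡1 : ∀ {n} j (A : Subset n) → isSingleton≥ j A ≡ true → ∣ A ∣ ≡ 1
isSingleton≥⇒size≡1 {suc n} zero (true ∷ A) e = cong suc (trans (cong ∣_∣ (isEmpty⇒≡⊥ A e)) (∣⊥∣≡0 n))
isSingleton≥⇒size≡1 zero    (false ∷ A) e = isSingleton≥⇒size≡1 zero A e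
isSingleton≥⇒size≡1 (suc j) (false ∷ A) e = isSingleton≥⇒size≡1 j A e

isPair≥⇒size≡2 : ∀ {n} i j (A : Subset n) → isPair≥ i j A ≡ true → ∣ A ∣ ≡ 2
isPair≥⇒size≡2 zero    j (true ∷ A)  e = cong suc (isSingleton≥⇒size≡1 (j ∸ 1) A e)
isPair≥⇒size≡2 zero    j (false ∷ A) e = isPair≥⇒size≡2 zero (j ∸ 1) A e
isPair≥⇒size≡2 (suc i) j (false ∷ A) e = isPair≥⇒size≡2 i (j ∸ 1) A e

count-isEmpty : ∀ n → count (isEmpty {n}) (allSubsets n) ≡ 1
count-isEmpty zero = refl
count-isEmpty (suc n) rewrite count-allSubsets-suc n isEmpty | count-false (allSubsets n) =
  count-isEmpty n

count-isSingleton≥ : ∀ n j → count (isSingleton≥ {n} j) (allSubsets n) ≡ n ∸ j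
count-isSingleton≥ zero    j = sym (0∸n≡0 j)
count-isSingleton≥ (suc n) zero rewrite count-allSubsets-suc n (isSingleton≥ zero) =
  cong₂ _+_ (count-isEmpty n) (count-isSingleton≥ n zero)
count-isSingleton≥ (suc n) (suc j)
  rewrite count-allSubsets-suc n (isSingleton≥ (suc j)) | count-false (allSubsets n) =
  count-isSingleton≥ n j

pairBound : ℕ → ℕ → ℕ → ℕ
pairBound n i j = (n + suc j ∸ 2 * suc i) * (n ∸ j)

pairBound-suc : ∀ n i j → pairBound (suc n) (suc i) (suc j) ≡ pairBound n i j
pairBound-suc n i j =
  cong (_* (n ∸ j)) (cong₂ _∸_ (cong suc (+-suc n (suc j))) (*-suc 2 (suc i)))

pairBound-zero-zero : ∀ n → 2 * n + pairBound n 0 0 ≡ pairBound (suc n) 0 0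
pairBound-zero-zero zero    = refl
pairBound-zero-zero (suc m) rewrite m+n∸n≡m m 1 | m+n∸n≡m (suc m) 1 =
  trans (sym (*-distribʳ-+ (suc m) 2 m)) (*-comm (2 + m) (suc m))

pairBound-zero-suc : ∀ n j → 2 * (n ∸ j) + pairBound n 0 j ≡ pairBound (suc n) 0 (suc j)
pairBound-zero-suc zero    j rewrite 0∸n≡0 j | *-zeroʳ (j ∸ 1) | *-zeroʳ j = refl
pairBound-zero-suc (suc m) j rewrite +-suc m j | +-suc m (suc j) | +-suc m j =
  sym (*-distribʳ-+ (suc m ∸ j) 2 (m + j))

twice-count-isPair≥ : ∀ n i j → i ≤ j → 2 * count (isPair≥ {n} i j) (allSubsets n) ≡ pairBound n i j
twice-count-isPair≥ zero i j _ rewrite 0∸n≡0 j | *-zeroʳ (suc j ∸ 2 * suc i) = refl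
twice-count-isPair≥ (suc n) (suc i) (suc j) (s≤s i≤j)
  rewrite count-allSubsets-suc n (isPair≥ (suc i) (suc j)) | count-false (allSubsets n) =
  trans (twice-count-isPair≥ n i j i≤j) (sym (pairBound-suc n i j))
twice-count-isPair≥ (suc n) zero zero _
  rewrite count-allSubsets-suc n (isPair≥ zero zero) | count-isSingleton≥ n zero
        | *-distribˡ-+ 2 n (count (isPair≥ zero zero) (allSubsets n))
        | twice-count-isPair≥ n zero zero z≤n = pairBound-zero-zero n
twice-count-isPair≥ (suc n) zero (suc j) _
  rewrite count-allSubsets-suc n (isPair≥ zero (suc j)) | count-isSingleton≥ n j
        | *-distribˡ-+ 2 (n ∸ j) (count (isPair≥ zero j) (allSubsets n))
        | twice-count-isPair≥ n zero j z≤n = pairBound-zero-suc n j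

Shifted⇒closed : ∀ {n} {F : Family n} → Shifted F →
                 ∀ {A B} → F A ≡ true → CanShiftTo A B → F B ≡ true
Shifted⇒closed sh FA ε = FA
Shifted⇒closed sh {A} FA ((a , b , a<b , shiftA≡) ◅ rest) =
  Shifted⇒closed sh (proj₁ (sh a b a<b _) (inj₁ (A , FA , shiftA≡))) rest

shift-∷ : ∀ {n} x (A : Subset n) a b → shift (suc a) (suc b) (x ∷ A) ≡ x ∷ shift a b A
shift-∷ x A a b with lookup A b ∧ not (lookup A a)
... | true  = refl
... | false = refl

CanShiftTo-∷ : ∀ {n} (x : Bool) {A B : Subset n} → CanShiftTo A B → CanShiftTo (x ∷ A) (x ∷ B)
CanShiftTo-∷ x = gmap (x ∷_) λ { {A} (a , b , a<b , shiftA≡B) →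
  suc a , suc b , s≤s a<b , trans (shift-∷ x A a b) (cong (x ∷_) shiftA≡B) }

shift-to-zero : ∀ {n} {A B : Subset n} p → lookup A p ≡ true → A [ p ]≔ false ≡ B →
                ShiftStep (false ∷ A) (true ∷ B)
shift-to-zero {A = A} p A∋p refl =
  zero , suc p , s≤s z≤n , cong (λ b → if b ∧ true then true ∷ (A [ p ]≔ false) else false ∷ A) A∋p

isSingleton≥-zero-min : ∀ {n} (A : Subset n) → isSingleton≥ zero A ≡ true →
  Σ (Fin n) λ p → (lookup A p ≡ true) × (isEmpty (A [ p ]≔ false) ≡ true)
isSingleton≥-zero-min (true ∷ A)  e = zero , refl , e
isSingleton≥-zero-min (false ∷ A) e with isSingleton≥-zero-min A e
... | p , A∋p , rest = suc p , A∋p , rest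

isPair≥-zero-min : ∀ {n} j (A : Subset n) → isPair≥ zero j A ≡ true →
  Σ (Fin n) λ p → (lookup A p ≡ true) × (isSingleton≥ j (A [ p ]≔ false) ≡ true)
isPair≥-zero-min zero    (true ∷ A)  e = zero , refl , e
isPair≥-zero-min (suc j) (true ∷ A)  e = zero , refl , e
isPair≥-zero-min zero    (false ∷ A) e with isPair≥-zero-min zero A e
... | p , A∋p , rest = suc p , A∋p , rest
isPair≥-zero-min (suc j) (false ∷ A) e with isPair≥-zero-min j A e
... | p , A∋p , rest = suc p , A∋p , rest

isSingleton≥⇒CanShiftTo : ∀ {n} (j : Fin n) (A : Subset n) →
                          isSingleton≥ (toℕ j) A ≡ true → CanShiftTo A ⁅ j ⁆
isSingleton≥⇒CanShiftTo zero (true ∷ A) e rewrite isEmpty⇒≡⊥ A e = ε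
isSingleton≥⇒CanShiftTo zero (false ∷ A) e with isSingleton≥-zero-min A e
... | p , A∋p , rest = shift-to-zero p A∋p (isEmpty⇒≡⊥ _ rest) ◅ ε
isSingleton≥⇒CanShiftTo (suc j) (false ∷ A) e = CanShiftTo-∷ false (isSingleton≥⇒CanShiftTo j A e)

isPair≥⇒CanShiftTo : ∀ {n} (i j : Fin n) → i < j → (A : Subset n) →
                     isPair≥ (toℕ i) (toℕ j) A ≡ true → CanShiftTo A (⁅ i ⁆ ∪ ⁅ j ⁆)
isPair≥⇒CanShiftTo (suc i) (suc j) (s≤s i<j) (false ∷ A) e =
  CanShiftTo-∷ false (isPair≥⇒CanShiftTo i j i<j A e)
isPair≥⇒CanShiftTo zero (suc j) _ (true ∷ A) e rewrite ∪-identityˡ ⁅ j ⁆ =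
  CanShiftTo-∷ true (isSingleton≥⇒CanShiftTo j A e)
isPair≥⇒CanShiftTo zero (suc j) _ (false ∷ A) e with isPair≥-zero-min (toℕ j) A e
... | p , A∋p , rest rewrite ∪-identityˡ ⁅ j ⁆ =
  shift-to-zero p A∋p refl ◅ CanShiftTo-∷ true (isSingleton≥⇒CanShiftTo j _ rest)

missingPair : ∀ {n} → Family n → Subset n → Bool
missingPair F A = (∣ A ∣ ≡ᵇ 2) ∧ not (F A)

y2≡count-missingPair : ∀ {n} (F : Family n) → y2 F ≡ count (missingPair F) (allSubsets n)
y2≡count-missingPair {n} F = begin
  n C 2 ∸ card2 F
    ≡⟨ cong₂ _∸_ (sym (count-size≡C n 2)) (length-filter≡count (λ A → F A ∧ size2 A) subsets) ⟩
  count size2 subsets ∸ count (λ A → F A ∧ size2 A) subsets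
    ≡⟨ cong₂ _∸_ (count-∧-not size2 F subsets) (count-cong (λ A → ∧-comm (F A) (size2 A)) subsets) ⟩
  count (λ A → size2 A ∧ F A) subsets + count (missingPair F) subsets ∸ count (λ A → size2 A ∧ F A) subsets
    ≡⟨ m+n∸m≡n (count (λ A → size2 A ∧ F A) subsets) _ ⟩
  count (missingPair F) subsets ∎
  where
  open ≡-Reasoning
  subsets = allSubsets n
  size2 : Subset n → Bool
  size2 A = ∣ A ∣ ≡ᵇ 2

Shifted⇒CanShiftTo-∉ : ∀ {n} {F : Family n} → Shifted F → ∀ {A B} →
                       F B ≡ false → CanShiftTo A B → F A ≡ false
Shifted⇒CanShiftTo-∉ {F = F} sh {A} FB A↝B with F A in FA
... | true  = contradiction FB (not-¬ (Shifted⇒closed sh FA A↝B))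
... | false = refl

isPair≥⇒missingPair : ∀ {n} {F : Family n} {i j} → Shifted F → i < j →
  F (⁅ i ⁆ ∪ ⁅ j ⁆) ≡ false → ∀ A → isPair≥ (toℕ i) (toℕ j) A ≡ true → missingPair F A ≡ true
isPair≥⇒missingPair {i = i} {j} sh i<j Fij A e
  rewrite isPair≥⇒size≡2 (toℕ i) (toℕ j) A e
        | Shifted⇒CanShiftTo-∉ sh Fij (isPair≥⇒CanShiftTo i j i<j A e) = refl

lemma7 : ∀ (n : ℕ) (F : Family n) (i j : Fin n) → Shifted F → i < j →
  F (⁅ i ⁆ ∪ ⁅ j ⁆) ≡ false →
  ((n + suc (toℕ j) ∸ 2 * suc (toℕ i)) * (n ∸ toℕ j) ≤ 2 * y2 F)
  × (2 * y2 F ≡ (n + suc (toℕ j) ∸ 2 * suc (toℕ i)) * (n ∸ toℕ j) →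
     ∀ (A : Subset n) → ∣ A ∣ ≡ 2 →
     ((F A ≡ true → ¬ CanShiftTo A (⁅ i ⁆ ∪ ⁅ j ⁆))
      × (¬ CanShiftTo A (⁅ i ⁆ ∪ ⁅ j ⁆) → F A ≡ true)))
lemma7 n F i j sh i<j Fij = bound , tight⇒characterised
  where
  pairs = isPair≥ (toℕ i) (toℕ j)
  missing = missingPair F
  pairs⊆missing = isPair≥⇒missingPair sh i<j Fij

  twice-pairs : 2 * count pairs (allSubsets n) ≡ pairBound n (toℕ i) (toℕ j)
  twice-pairs = twice-count-isPair≥ n (toℕ i) (toℕ j) (<⇒≤ i<j)

  twice-y2 : 2 * y2 F ≡ 2 * count missing (allSubsets n)
  twice-y2 = cong (2 *_) (y2≡count-missingPair F)

  bound : pairBound n (toℕ i) (toℕ j) ≤ 2 * y2 F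
  bound = subst₂ _≤_ twice-pairs (sym twice-y2)
                 (*-monoʳ-≤ 2 (count-mono pairs⊆missing (allSubsets n)))

  tight⇒characterised : 2 * y2 F ≡ pairBound n (toℕ i) (toℕ j) → ∀ A → ∣ A ∣ ≡ 2 →
    (F A ≡ true → ¬ CanShiftTo A (⁅ i ⁆ ∪ ⁅ j ⁆)) × (¬ CanShiftTo A (⁅ i ⁆ ∪ ⁅ j ⁆) → F A ≡ true)
  tight⇒characterised tight A ∣A∣≡2 =
    (λ FA A↝ij → not-¬ FA (Shifted⇒CanShiftTo-∉ sh Fij A↝ij)) , inF
    where
    pairs≡missing : count pairs (allSubsets n) ≡ count missing (allSubsets n)
    pairs≡missing = *-cancelˡ-≡ _ _ 2 (trans twice-pairs (trans (sym tight) twice-y2))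

    inF : ¬ CanShiftTo A (⁅ i ⁆ ∪ ⁅ j ⁆) → F A ≡ true
    inF ¬A↝ij with F A in FA
    ... | true  = refl
    ... | false = contradiction (isPair≥⇒CanShiftTo i j i<j A pairsA) ¬A↝ij
      where
      missingA : missing A ≡ true
      missingA rewrite ∣A∣≡2 | FA = refl
      pairsA : pairs A ≡ true
      pairsA = count-mono-≡⇒ pairs⊆missing pairs≡missing (∈-allSubsets A) missingA
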